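{- Let $G$ be a finite group. Then $\mathcal{P}_e(G)$ is $2K_2$-free if and only if $G$ is a cyclic group, a dihedral group, or an elementary abelian $2$-group.
   Context: For a finite group $G$, the enhanced power graph $\mathcal{P}_e(G)$ is the simple graph with vertex set $G$ in which two distinct vertices $x,y$ are adjacent if and only if $\langle x,y\rangle$ is cyclic. A graph is $2K_2$-free if it has no induced subgraph isomorphic to the disjoint union of two copies of $K_2$. The dihedral group $D_{2n}$ of order $2n$ is $\langle a,b : a^n=b^2=e,\ bab=a^{ -1}\rangle$. An elementary abelian $2$-group is a group isomorphic to $\mathbb{Z}_2^m$ for some $m$. -}

module Defs where

open import Level using (Level; _⊔_)
open import Algebra.Bundles using (Group)
open import Data.Nat using (ℕ; zero; suc; _*_)
open import Data.Integer using (ℤ; +_; -[1+_])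
open import Data.Fin using (Fin; toℕ)
open import Data.Product using (Σ; ∃; ∃-syntax; _×_; _,_)
open import Data.Sum using (_⊎_)
open import Relation.Nullary using (¬_)
open import Relation.Binary.PropositionalEquality using (_≡_)

module _ {c ℓ : Level} (G : Group c ℓ) where
  open Group G

  powℕ : Carrier → ℕ → Carrier
  powℕ x zero    = ε
  powℕ x (suc n) = x ∙ powℕ x n

  pow : Carrier → ℤ → Carrier
  pow x (+ n)     = powℕ x n
  pow x -[1+ n ]  = (powℕ x (suc n)) ⁻¹

  data InGen (x y : Carrier) : Carrier → Set (c ⊔ ℓ) where
    gen-x   : InGen x y x
    gen-y   : InGen x y y
    gen-ε   : InGen x y ε
    gen-∙   : ∀ {u v} → InGen x y u → InGen x y v → InGen x y (u ∙ v)
    gen-⁻¹  : ∀ {u} → InGen x y u → InGen x y (u ⁻¹)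
    gen-≈   : ∀ {u v} → u ≈ v → InGen x y u → InGen x y v

  GenCyclic : Carrier → Carrier → Set (c ⊔ ℓ)
  GenCyclic x y = ∃[ g ] (InGen x y g × (∀ u → InGen x y u → ∃[ k ] (u ≈ pow g k)))

  -- adjacency in the enhanced power graph
  Adj : Carrier → Carrier → Set (c ⊔ ℓ)
  Adj x y = (¬ (x ≈ y)) × GenCyclic x y

  TwoK2Free : Set (c ⊔ ℓ)
  TwoK2Free = ∀ x₁ y₁ x₂ y₂ →
    ¬ ( ¬ (x₁ ≈ x₂) × ¬ (x₁ ≈ y₂) × ¬ (y₁ ≈ x₂) × ¬ (y₁ ≈ y₂)
      × Adj x₁ y₁ × Adj x₂ y₂
      × ¬ Adj x₁ x₂ × ¬ Adj x₁ y₂ × ¬ Adj y₁ x₂ × ¬ Adj y₁ y₂ )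

  HasOrder : ℕ → Set (c ⊔ ℓ)
  HasOrder m = Σ (Fin m → Carrier) λ f →
    (∀ x → ∃[ i ] (f i ≈ x)) × (∀ i j → f i ≈ f j → i ≡ j)

  Finite : Set (c ⊔ ℓ)
  Finite = ∃[ m ] HasOrder m

  IsCyclic : Set (c ⊔ ℓ)
  IsCyclic = ∃[ g ] (∀ x → ∃[ k ] (x ≈ pow g k))

  -- G ≅ D_{2n} = ⟨a, b | aⁿ = b² = e, bab = a⁻¹⟩ for some n:
  -- G has order 2n and elements a, b satisfying the relations
  -- such that every element is aⁱ bʲ (0 ≤ i < n, 0 ≤ j < 2)
  IsDihedral : Set (c ⊔ ℓ)
  IsDihedral = ∃[ n ] (HasOrder (2 * n) × ∃[ a ] ∃[ b ]
    ( powℕ a n ≈ ε × b ∙ b ≈ ε × (b ∙ a) ∙ b ≈ a ⁻¹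
    × (∀ x → ∃[ i ] ∃[ j ] (x ≈ powℕ a (toℕ {n} i) ∙ powℕ b (toℕ {2} j)))))

  IsElemAbelian2 : Set (c ⊔ ℓ)
  IsElemAbelian2 = (∀ x y → x ∙ y ≈ y ∙ x) × (∀ x → x ∙ x ≈ ε)

{-# OPTIONS --safe #-}

-- Every element other than e is adjacent to e, so no edge of an induced 2K₂ contains e.  Hence
-- 𝒫ₑ(G) is 2K₂-free once its vertices split into a clique and vertices all of whose edges contain
-- e: a cyclic group is a clique; in D₂ₙ the rotations form a clique, and a cyclic subgroup
-- containing a reflection s is {e, s}; in an elementary abelian 2-group every cyclic subgroup is
-- {e, k}.
--
-- Conversely, if some element is not an involution, pick g of maximal order n > 2.  When
-- ⟨u, v⟩ = ⟨k⟩ and g ∈ ⟨u⟩, maximality gives ⟨k⟩ = ⟨g⟩; so for h ∉ ⟨g⟩ the edges {g, g⁻¹} and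
-- {h, h⁻¹} would form an induced 2K₂ unless h = h⁻¹.  Thus every element outside ⟨g⟩ is an
-- involution, and such elements invert ⟨g⟩ by conjugation.  For two of them x, b the product x b
-- then centralises g, so x b ∈ ⟨g⟩ as g ≠ g⁻¹: either G = ⟨g⟩ or G = ⟨g⟩ ∪ ⟨g⟩ b ≅ D₂ₙ.

module Submission where

open import Defs
open import Level using (Level; _⊔_)
open import Algebra.Bundles using (Group)
open import Data.Empty using (⊥; ⊥-elim)
open import Data.Unit using (⊤; tt)
open import Data.Nat
  using (ℕ; zero; suc; _+_; _*_; _∸_; _≤_; _<_; z≤n; s≤s; NonZero; >-nonZero; >-nonZero⁻¹; ≢-nonZero⁻¹; s<s⁻¹)
open import Data.Nat.Properties
open import Algebra.Properties.CommutativeSemigroup *-commutativeSemigroup using (x∙yz≈y∙xz)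
open import Data.Nat.DivMod using (_mod_; _divMod_; DivMod)
open import Data.Nat.Divisibility using (_∣_; divides; quotient≢0)
open import Data.Nat.GCD using (gcd; gcd-GCD; gcd[m,n]∣m; gcd[m,n]∣n; gcd[m,n]≢0; module Bézout)
open import Data.Nat.Coprimality using (Coprime; coprime-Bézout; gcd≡1⇒coprime)
open import Data.Integer using (+_; -[1+_])
open import Data.Fin using (Fin; toℕ)
open import Data.Fin.Patterns using (0F; 1F)
open import Data.Fin.Properties
  using (any?; all?; ¬∀⟶∃¬; pigeonhole; toℕ<n; toℕ-injective; *↔×; nonZeroIndex; injective⇒≤)
  renaming (_≟_ to _≟F_)
open import Data.List using (List; tabulate)
open import Data.List.Extrema.Nat using (argmax; f[xs]≤f[argmax])
open import Data.List.Membership.Propositional.Properties using (∈-tabulate⁺)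
import Data.List.Relation.Unary.All as All
open import Data.Product using (∃; ∃₂; ∃-syntax; _×_; _,_; proj₁; proj₂)
open import Data.Sum using (_⊎_; inj₁; inj₂; [_,_]; swap)
import Data.Sum as Sum
open import Function using (_∘_; id; _↔_; Inverse; Injection)
open import Function.Bundles using (_⇔_; mk⇔)
open import Function.Properties.Inverse using (↔⇒↣)
open import Relation.Nullary using (¬_; Dec; yes; no; contradiction)
open import Relation.Nullary.Decidable using (decidable-stable)
import Relation.Nullary.Decidable as Dec
open import Relation.Unary using (Pred; Decidable)
open import Relation.Binary.Definitions using (tri<; tri≈; tri>)
open import Relation.Binary.PropositionalEquality as ≡ using (_≡_)

least-witness : ∀ {p} {P : Pred ℕ p} → Decidable P → ∀ n → P n →
                ∃[ t ] (P t × (∀ {s} → s < t → ¬ P s))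
least-witness P? zero    P0 = 0 , P0 , λ ()
least-witness P? (suc n) Pn with P? 0
... | yes P0  = 0 , P0 , λ ()
... | no ¬P0 with least-witness (P? ∘ suc) n Pn
...   | t , Pt , below = suc t , Pt , λ { {zero} _ → ¬P0 ; {suc s} s<t → below (s<s⁻¹ s<t) }

module Powers {c ℓ : Level} (G : Group c ℓ) where
  open Group G
  open import Algebra.Properties.Group G using (inverseʳ-unique; identityʳ-unique; ε⁻¹≈ε; ⁻¹-anti-homo-∙)
  open import Algebra.Properties.Monoid.Mult monoid
    using (×-congʳ; ×-homo-+; ×-assocˡ) renaming (_×_ to _·_)
  open import Relation.Binary.Reasoning.Setoid setoid

  infixr 8 _^_
  _^_ : Carrier → ℕ → Carrier
  _^_ = powℕ G

  ^≡· : ∀ x n → x ^ n ≡ n · x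
  ^≡· x zero    = ≡.refl
  ^≡· x (suc n) = ≡.cong (x ∙_) (^≡· x n)

  ^-cong : ∀ n {x y} → x ≈ y → x ^ n ≈ y ^ n
  ^-cong n {x} {y} x≈y rewrite ^≡· x n | ^≡· y n = ×-congʳ n x≈y

  ^-+ : ∀ x m n → x ^ (m + n) ≈ x ^ m ∙ x ^ n
  ^-+ x m n rewrite ^≡· x (m + n) | ^≡· x m | ^≡· x n = ×-homo-+ x m n

  ^-* : ∀ x m n → x ^ (m * n) ≈ (x ^ n) ^ m
  ^-* x m n rewrite ^≡· x n | ^≡· (n · x) m | ^≡· x (m * n) = sym (×-assocˡ x m n)

  ε^ : ∀ n → ε ^ n ≈ ε
  ε^ zero    = refl
  ε^ (suc n) = trans (identityˡ _) (ε^ n)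

  ^-sucʳ : ∀ x i → x ^ suc i ≈ x ^ i ∙ x
  ^-sucʳ x i =
    trans (reflexive (≡.cong (x ^_) (+-comm 1 i))) (trans (^-+ x i 1) (∙-congˡ (identityʳ x)))

  ⁻¹-^ : ∀ x i → (x ⁻¹) ^ i ≈ (x ^ i) ⁻¹
  ⁻¹-^ x zero    = sym ε⁻¹≈ε
  ⁻¹-^ x (suc i) = begin
    x ⁻¹ ∙ (x ⁻¹) ^ i   ≈⟨ ∙-congˡ (⁻¹-^ x i) ⟩
    x ⁻¹ ∙ (x ^ i) ⁻¹   ≈⟨ ⁻¹-anti-homo-∙ (x ^ i) x ⟨
    (x ^ i ∙ x) ⁻¹      ≈⟨ ⁻¹-cong (^-sucʳ x i) ⟨
    (x ^ suc i) ⁻¹      ∎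

  intertwine-^ : ∀ {b x z} → b ∙ x ≈ z ∙ b → ∀ i → b ∙ x ^ i ≈ z ^ i ∙ b
  intertwine-^ {b} bx≈zb zero = trans (identityʳ b) (sym (identityˡ b))
  intertwine-^ {b} {x} {z} bx≈zb (suc i) = begin
    b ∙ (x ∙ x ^ i)     ≈⟨ assoc _ _ _ ⟨
    (b ∙ x) ∙ x ^ i     ≈⟨ ∙-congʳ bx≈zb ⟩
    (z ∙ b) ∙ x ^ i     ≈⟨ assoc _ _ _ ⟩
    z ∙ (b ∙ x ^ i)     ≈⟨ ∙-congˡ (intertwine-^ bx≈zb i) ⟩
    z ∙ (z ^ i ∙ b)     ≈⟨ assoc _ _ _ ⟨
    (z ∙ z ^ i) ∙ b     ∎

  ^-*-period : ∀ {x p} → x ^ p ≈ ε → ∀ q → x ^ (q * p) ≈ ε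
  ^-*-period {x} {p} xᵖ≈ε q = trans (^-* x q p) (trans (^-cong q xᵖ≈ε) (ε^ q))

  ^-mod : ∀ {x n} .{{_ : NonZero n}} → x ^ n ≈ ε → ∀ k → x ^ k ≈ x ^ toℕ (k mod n)
  ^-mod {x} {n} xⁿ≈ε k = begin
    x ^ k                                      ≡⟨ ≡.cong (x ^_) (DivMod.property (k divMod n)) ⟩
    x ^ (toℕ (k mod n) + q * n)                ≈⟨ ^-+ x (toℕ (k mod n)) (q * n) ⟩
    x ^ toℕ (k mod n) ∙ x ^ (q * n)            ≈⟨ ∙-congˡ (^-*-period xⁿ≈ε q) ⟩
    x ^ toℕ (k mod n) ∙ ε                      ≈⟨ identityʳ _ ⟩
    x ^ toℕ (k mod n)                          ∎
    where
    q : ℕ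
    q = DivMod.quotient (k divMod n)

  ^-inverse : ∀ {x t} → x ^ suc t ≈ ε → ∀ i → (x ^ i) ⁻¹ ≈ x ^ (i * t)
  ^-inverse {x} {t} xᵗ⁺¹≈ε i = sym (inverseʳ-unique (x ^ i) (x ^ (i * t)) (begin
    x ^ i ∙ x ^ (i * t)   ≈⟨ ^-+ x i (i * t) ⟨
    x ^ (i + i * t)       ≡⟨ ≡.cong (x ^_) (*-suc i t) ⟨
    x ^ (i * suc t)       ≈⟨ ^-*-period xᵗ⁺¹≈ε i ⟩
    ε                     ∎))

  ^≈^⇒^∸≈ε : ∀ {x i j} → i ≤ j → x ^ i ≈ x ^ j → x ^ (j ∸ i) ≈ ε
  ^≈^⇒^∸≈ε {x} {i} {j} i≤j xⁱ≈xʲ = identityʳ-unique (x ^ i) (x ^ (j ∸ i)) (begin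
    x ^ i ∙ x ^ (j ∸ i)   ≈⟨ ^-+ x i (j ∸ i) ⟨
    x ^ (i + (j ∸ i))     ≡⟨ ≡.cong (x ^_) (m+[n∸m]≡n i≤j) ⟩
    x ^ j                 ≈⟨ xⁱ≈xʲ ⟨
    x ^ i                 ∎)

  Torsion : Set (c ⊔ ℓ)
  Torsion = ∀ x → ∃[ t ] (x ^ suc t ≈ ε)

  infix 4 _∈⟨_⟩
  _∈⟨_⟩ : Carrier → Carrier → Set ℓ
  y ∈⟨ x ⟩ = ∃[ i ] (y ≈ x ^ i)

  x∈⟨x⟩ : ∀ x → x ∈⟨ x ⟩
  x∈⟨x⟩ x = 1 , sym (identityʳ x)

  ∈⟨⟩-resp-≈ : ∀ {x y z} → y ≈ z → y ∈⟨ x ⟩ → z ∈⟨ x ⟩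
  ∈⟨⟩-resp-≈ y≈z (i , y≈xⁱ) = i , trans (sym y≈z) y≈xⁱ

  ∈⟨⟩-∙ : ∀ {x y z} → y ∈⟨ x ⟩ → z ∈⟨ x ⟩ → y ∙ z ∈⟨ x ⟩
  ∈⟨⟩-∙ {x} (i , y≈xⁱ) (j , z≈xʲ) = i + j , trans (∙-cong y≈xⁱ z≈xʲ) (sym (^-+ x i j))

  ∈⟨⟩-trans : ∀ {x y z} → z ∈⟨ y ⟩ → y ∈⟨ x ⟩ → z ∈⟨ x ⟩
  ∈⟨⟩-trans {x} (i , z≈yⁱ) (j , y≈xʲ) = i * j , trans z≈yⁱ (trans (^-cong i y≈xʲ) (sym (^-* x i j)))

  divisor-power : ∀ {x w d i} → d ∣ i → w ≈ x ^ i → w ∈⟨ x ^ d ⟩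
  divisor-power {x} {d = d} (divides q i≡qd) w≈xⁱ =
    q , trans w≈xⁱ (trans (reflexive (≡.cong (x ^_) i≡qd)) (^-* x q d))

  record IsOrder (x : Carrier) (n : ℕ) : Set ℓ where
    field
      positive    : 0 < n
      annihilates : x ^ n ≈ ε
      least       : ∀ {s} → 0 < s → x ^ s ≈ ε → n ≤ s
  open IsOrder public

  IsOrder-resp-≈ : ∀ {x y n} → x ≈ y → IsOrder x n → IsOrder y n
  IsOrder-resp-≈ {n = n} x≈y x-order = record
    { positive    = positive x-order
    ; annihilates = trans (sym (^-cong n x≈y)) (annihilates x-order)
    ; least       = λ {s} 0<s yˢ≈ε → least x-order 0<s (trans (^-cong s x≈y) yˢ≈ε)
    }

  IsOrder-unique : ∀ {x m n} → IsOrder x m → IsOrder x n → m ≡ n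
  IsOrder-unique m-order n-order = ≤-antisym
    (least m-order (positive n-order) (annihilates n-order))
    (least n-order (positive m-order) (annihilates m-order))

  ^-injective : ∀ {x n i j} → IsOrder x n → i < n → j < n → x ^ i ≈ x ^ j → i ≡ j
  ^-injective {x} {n} {i} {j} x-order i<n j<n xⁱ≈xʲ with <-cmp i j
  ... | tri≈ _ i≡j _ = i≡j
  ... | tri< i<j _ _ = contradiction
    (least x-order (m<n⇒0<n∸m i<j) (^≈^⇒^∸≈ε (<⇒≤ i<j) xⁱ≈xʲ))
    (<⇒≱ (≤-<-trans (m∸n≤m j i) j<n))
  ... | tri> _ _ j<i = contradiction
    (least x-order (m<n⇒0<n∸m j<i) (^≈^⇒^∸≈ε (<⇒≤ j<i) (sym xⁱ≈xʲ)))
    (<⇒≱ (≤-<-trans (m∸n≤m i j) i<n))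

  involution⇒order≤2 : ∀ {x n} → IsOrder x n → x ∙ x ≈ ε → n ≤ 2
  involution⇒order≤2 {x} x-order x²≈ε = least x-order (s≤s z≤n) (trans (∙-congˡ (identityʳ x)) x²≈ε)

  order≤2⇒involution : ∀ {x n} → IsOrder x n → n ≤ 2 → x ∙ x ≈ ε
  order≤2⇒involution {n = zero} x-order _ = contradiction (positive x-order) λ ()
  order≤2⇒involution {x} {n = 1} x-order _ = trans (∙-cong x≈ε x≈ε) (identityˡ ε)
    where
    x≈ε : x ≈ ε
    x≈ε = trans (sym (identityʳ x)) (annihilates x-order)
  order≤2⇒involution {x} {n = 2} x-order _ = trans (∙-congˡ (sym (identityʳ x))) (annihilates x-order)
  order≤2⇒involution {n = suc (suc (suc _))} _ (s≤s (s≤s ()))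

  -- With d = gcd p m and m = q * d, g ^ q ≈ ε gives n ≤ q, so q * d = m ≤ n ≤ q and d = 1.
  order≤period⇒coprime : ∀ {g n k p m} → IsOrder g n → g ≈ k ^ p → k ^ m ≈ ε → 0 < m → m ≤ n →
                         Coprime p m
  order≤period⇒coprime {g} {n} {k} {p} {m} g-order g≈kᵖ kᵐ≈ε 0<m m≤n =
    gcd≡1⇒coprime (≤-antisym (*-cancelˡ-≤ q qd≤q*1) 0<d)
    where
    instance
      m≢0 : NonZero m
      m≢0 = >-nonZero 0<m
    d : ℕ
    d = gcd p m
    open _∣_ (gcd[m,n]∣m p m) using () renaming (quotient to p′; equality to p≡p′d)
    open _∣_ (gcd[m,n]∣n p m) using () renaming (quotient to q; equality to m≡qd)
    instance
      q≢0 : NonZero q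
      q≢0 = quotient≢0 (gcd[m,n]∣n p m)
    gᵠ≈ε : g ^ q ≈ ε
    gᵠ≈ε = begin
      g ^ q                ≈⟨ ^-cong q g≈kᵖ ⟩
      (k ^ p) ^ q          ≈⟨ ^-* k q p ⟨
      k ^ (q * p)          ≡⟨ ≡.cong (λ e → k ^ (q * e)) p≡p′d ⟩
      k ^ (q * (p′ * d))   ≡⟨ ≡.cong (k ^_) (x∙yz≈y∙xz q p′ d) ⟩
      k ^ (p′ * (q * d))   ≡⟨ ≡.cong (λ e → k ^ (p′ * e)) m≡qd ⟨
      k ^ (p′ * m)         ≈⟨ ^-*-period kᵐ≈ε p′ ⟩
      ε                    ∎
    qd≤q*1 : q * d ≤ q * 1
    qd≤q*1 = ≡.subst₂ _≤_ m≡qd (≡.sym (*-identityʳ q))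
               (≤-trans m≤n (least g-order (>-nonZero⁻¹ q) gᵠ≈ε))
    0<d : 0 < d
    0<d = n≢0⇒n>0 (gcd[m,n]≢0 p m (inj₂ (≢-nonZero⁻¹ m)))

module Involutions {c ℓ : Level} (G : Group c ℓ) where
  open Group G
  open import Algebra.Properties.Group G using (inverseˡ-unique; ⁻¹-anti-homo-∙)
  open import Relation.Binary.Reasoning.Setoid setoid
  open Powers G

  involution⁻¹ : ∀ {x} → x ∙ x ≈ ε → x ⁻¹ ≈ x
  involution⁻¹ {x} x²≈ε = sym (inverseˡ-unique x x x²≈ε)

  ≈⁻¹⇒involution : ∀ {x} → x ≈ x ⁻¹ → x ∙ x ≈ ε
  ≈⁻¹⇒involution {x} x≈x⁻¹ = trans (∙-congˡ x≈x⁻¹) (inverseʳ x)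

  involution-∙-swap : ∀ {y z w} → y ∙ y ≈ ε → (y ∙ z) ∙ y ≈ w → y ∙ z ≈ w ∙ y
  involution-∙-swap {y} {z} {w} y²≈ε yzy≈w = begin
    y ∙ z               ≈⟨ identityʳ _ ⟨
    (y ∙ z) ∙ ε         ≈⟨ ∙-congˡ y²≈ε ⟨
    (y ∙ z) ∙ (y ∙ y)   ≈⟨ assoc _ _ _ ⟨
    ((y ∙ z) ∙ y) ∙ y   ≈⟨ ∙-congʳ yzy≈w ⟩
    w ∙ y               ∎

  involution-^ : ∀ {k} → k ∙ k ≈ ε → ∀ i → k ^ i ≈ ε ⊎ k ^ i ≈ k
  involution-^ k²≈ε zero = inj₁ refl
  involution-^ k²≈ε (suc i) with involution-^ k²≈ε i
  ... | inj₁ kⁱ≈ε = inj₂ (trans (∙-congˡ kⁱ≈ε) (identityʳ _))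
  ... | inj₂ kⁱ≈k = inj₁ (trans (∙-congˡ kⁱ≈k) k²≈ε)

  involution-∈⟨⟩-distinct : ∀ {k y z} → k ∙ k ≈ ε → y ∈⟨ k ⟩ → z ∈⟨ k ⟩ → ¬ y ≈ z → y ≈ ε ⊎ z ≈ ε
  involution-∈⟨⟩-distinct k²≈ε (i , y≈kⁱ) (j , z≈kʲ) y≉z
    with involution-^ k²≈ε i | involution-^ k²≈ε j
  ... | inj₁ kⁱ≈ε | _         = inj₁ (trans y≈kⁱ kⁱ≈ε)
  ... | inj₂ _    | inj₁ kʲ≈ε = inj₂ (trans z≈kʲ kʲ≈ε)
  ... | inj₂ kⁱ≈k | inj₂ kʲ≈k = contradiction (trans y≈kⁱ (trans kⁱ≈k (sym (trans z≈kʲ kʲ≈k)))) y≉z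

  involutions⇒IsElemAbelian2 : (∀ x → x ∙ x ≈ ε) → IsElemAbelian2 G
  involutions⇒IsElemAbelian2 x²≈ε = commute , x²≈ε
    where
    commute : ∀ x y → x ∙ y ≈ y ∙ x
    commute x y = begin
      x ∙ y           ≈⟨ involution⁻¹ (x²≈ε (x ∙ y)) ⟨
      (x ∙ y) ⁻¹      ≈⟨ ⁻¹-anti-homo-∙ x y ⟩
      y ⁻¹ ∙ x ⁻¹     ≈⟨ ∙-cong (involution⁻¹ (x²≈ε y)) (involution⁻¹ (x²≈ε x)) ⟩
      y ∙ x           ∎

module Generated {c ℓ : Level} (G : Group c ℓ) where
  open Group G
  open import Algebra.Properties.Group G using (x≈z//y)
  open import Relation.Binary.Reasoning.Setoid setoid
  open Powers G

  InGen-sym : ∀ {x y u} → InGen G x y u → InGen G y x u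
  InGen-sym gen-x       = gen-y
  InGen-sym gen-y       = gen-x
  InGen-sym gen-ε       = gen-ε
  InGen-sym (gen-∙ p q) = gen-∙ (InGen-sym p) (InGen-sym q)
  InGen-sym (gen-⁻¹ p)  = gen-⁻¹ (InGen-sym p)
  InGen-sym (gen-≈ e p) = gen-≈ e (InGen-sym p)

  Adj-sym : ∀ {x y} → Adj G x y → Adj G y x
  Adj-sym (x≉y , h , h∈ , cyclic) = x≉y ∘ sym , h , InGen-sym h∈ , λ u → cyclic u ∘ InGen-sym

  InGen-^ : ∀ {x y u} → InGen G x y u → ∀ i → InGen G x y (u ^ i)
  InGen-^ p zero    = gen-ε
  InGen-^ p (suc i) = gen-∙ p (InGen-^ p i)

  gcd-power∈InGen : ∀ {x y z i j} → y ≈ x ^ i → z ≈ x ^ j → InGen G y z (x ^ gcd i j)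
  gcd-power∈InGen {x} {y} {z} {i} {j} y≈xⁱ z≈xʲ = from-identity (Bézout.identity (gcd-GCD i j))
    where
    d : ℕ
    d = gcd i j
    shift : ∀ {v w m n} → v ≈ x ^ n → w ≈ x ^ m → ∀ a b → d + b * m ≡ a * n →
            x ^ d ∙ w ^ b ≈ v ^ a
    shift {v} {w} {m} {n} v≈xⁿ w≈xᵐ a b eq = begin
      x ^ d ∙ w ^ b         ≈⟨ ∙-congˡ (trans (^-cong b w≈xᵐ) (sym (^-* x b m))) ⟩
      x ^ d ∙ x ^ (b * m)   ≈⟨ ^-+ x d (b * m) ⟨
      x ^ (d + b * m)       ≡⟨ ≡.cong (x ^_) eq ⟩
      x ^ (a * n)           ≈⟨ ^-* x a n ⟩
      (x ^ n) ^ a           ≈⟨ ^-cong a v≈xⁿ ⟨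
      v ^ a                 ∎
    from-identity : Bézout.Identity d i j → InGen G y z (x ^ d)
    from-identity (Bézout.+- a b d+bj≡ai) =
      gen-≈ (sym (x≈z//y _ _ _ (shift y≈xⁱ z≈xʲ a b d+bj≡ai)))
            (gen-∙ (InGen-^ gen-x a) (gen-⁻¹ (InGen-^ gen-y b)))
    from-identity (Bézout.-+ a b d+ai≡bj) =
      gen-≈ (sym (x≈z//y _ _ _ (shift z≈xʲ y≈xⁱ b a d+ai≡bj)))
            (gen-∙ (InGen-^ gen-y b) (gen-⁻¹ (InGen-^ gen-x a)))

module Cardinality {c ℓ : Level} (G : Group c ℓ) where
  open Group G

  surjection⇒order≤ : ∀ {m k} → HasOrder G m → (h : Fin k → Carrier) → (∀ x → ∃[ i ] (x ≈ h i)) →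
                      m ≤ k
  surjection⇒order≤ (enum , _ , enum-injective) h onto = injective⇒≤ {f = preimage} preimage-injective
    where
    preimage : Fin _ → Fin _
    preimage i = proj₁ (onto (enum i))
    preimage-injective : ∀ {i j} → preimage i ≡ preimage j → i ≡ j
    preimage-injective {i} {j} same = enum-injective i j
      (trans (proj₂ (onto (enum i))) (trans (reflexive (≡.cong h same)) (sym (proj₂ (onto (enum j))))))

  bijection⇒HasOrder : ∀ {a m} {A : Set a} → Fin m ↔ A → (φ : A → Carrier) →
                       (∀ x → ∃[ u ] (x ≈ φ u)) → (∀ {u v} → φ u ≈ φ v → u ≡ v) → HasOrder G m
  bijection⇒HasOrder Fin↔A φ onto φ-injective =
    φ ∘ to ,
    (λ x → let u , x≈φu = onto x in from u , trans (reflexive (≡.cong φ (strictlyInverseˡ u))) (sym x≈φu)) ,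
    λ i j φi≈φj → Injection.injective (↔⇒↣ Fin↔A) (φ-injective φi≈φj)
    where open Inverse Fin↔A

module TorsionGroup {c ℓ : Level} (G : Group c ℓ) (torsion : Powers.Torsion G) where
  open Group G
  open import Algebra.Properties.Group G using (inverseˡ-unique)
  open import Relation.Binary.Reasoning.Setoid setoid
  open Powers G
  open Involutions G
  open Generated G

  ∈⟨⟩-⁻¹ : ∀ {x y} → y ∈⟨ x ⟩ → y ⁻¹ ∈⟨ x ⟩
  ∈⟨⟩-⁻¹ {x} (i , y≈xⁱ) = let t , xᵗ⁺¹≈ε = torsion x in
    i * t , trans (⁻¹-cong y≈xⁱ) (^-inverse xᵗ⁺¹≈ε i)

  pow∈⟨⟩ : ∀ x k → pow G x k ∈⟨ x ⟩
  pow∈⟨⟩ x (+ n)    = n , refl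
  pow∈⟨⟩ x -[1+ n ] = ∈⟨⟩-⁻¹ (suc n , refl)

  InGen⊆∈⟨⟩ : ∀ {h y z u} → y ∈⟨ h ⟩ → z ∈⟨ h ⟩ → InGen G y z u → u ∈⟨ h ⟩
  InGen⊆∈⟨⟩ y∈ z∈ gen-x       = y∈
  InGen⊆∈⟨⟩ y∈ z∈ gen-y       = z∈
  InGen⊆∈⟨⟩ y∈ z∈ gen-ε       = 0 , refl
  InGen⊆∈⟨⟩ y∈ z∈ (gen-∙ p q) = ∈⟨⟩-∙ (InGen⊆∈⟨⟩ y∈ z∈ p) (InGen⊆∈⟨⟩ y∈ z∈ q)
  InGen⊆∈⟨⟩ y∈ z∈ (gen-⁻¹ p)  = ∈⟨⟩-⁻¹ (InGen⊆∈⟨⟩ y∈ z∈ p)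
  InGen⊆∈⟨⟩ y∈ z∈ (gen-≈ e p) = ∈⟨⟩-resp-≈ e (InGen⊆∈⟨⟩ y∈ z∈ p)

  GenCyclic⇒∈⟨⟩ : ∀ {y z} → GenCyclic G y z → ∃[ k ] (y ∈⟨ k ⟩ × z ∈⟨ k ⟩)
  GenCyclic⇒∈⟨⟩ {y} {z} (k , _ , cyclic) = k , power-of-k gen-x , power-of-k gen-y
    where
    power-of-k : ∀ {u} → InGen G y z u → u ∈⟨ k ⟩
    power-of-k p = let i , u≈kⁱ = cyclic _ p in ∈⟨⟩-resp-≈ (sym u≈kⁱ) (pow∈⟨⟩ k i)

  ∈⟨⟩⇒GenCyclic : ∀ {x y z} → y ∈⟨ x ⟩ → z ∈⟨ x ⟩ → GenCyclic G y z
  ∈⟨⟩⇒GenCyclic {x} (i , y≈xⁱ) (j , z≈xʲ) =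
    x ^ gcd i j , gcd-power∈InGen {i = i} {j} y≈xⁱ z≈xʲ , λ u p →
      let k , u≈xᵈᵏ = InGen⊆∈⟨⟩ (divisor-power (gcd[m,n]∣m i j) y≈xⁱ) (divisor-power (gcd[m,n]∣n i j) z≈xʲ) p
      in + k , u≈xᵈᵏ

  ε-Adj : ∀ {e x} → e ≈ ε → ¬ e ≈ x → Adj G e x
  ε-Adj {x = x} e≈ε e≉x = e≉x , ∈⟨⟩⇒GenCyclic (0 , e≈ε) (x∈⟨x⟩ x)

  Adj-⁻¹ : ∀ {x} → ¬ x ∙ x ≈ ε → Adj G x (x ⁻¹)
  Adj-⁻¹ {x} x²≉ε = x²≉ε ∘ ≈⁻¹⇒involution , ∈⟨⟩⇒GenCyclic (x∈⟨x⟩ x) (∈⟨⟩-⁻¹ (x∈⟨x⟩ x))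

  coprime-power⇒∈⟨⟩ : ∀ {g k p m} → g ≈ k ^ p → k ^ m ≈ ε → Coprime p m → k ∈⟨ g ⟩
  coprime-power⇒∈⟨⟩ {g} {k} {p} {m} g≈kᵖ kᵐ≈ε coprime = from-identity (coprime-Bézout coprime)
    where
    kˣᵖ≈gˣ : ∀ x → k ^ (x * p) ≈ g ^ x
    kˣᵖ≈gˣ x = trans (^-* k x p) (^-cong x (sym g≈kᵖ))
    from-identity : Bézout.Identity 1 p m → k ∈⟨ g ⟩
    from-identity (Bézout.+- x y 1+ym≡xp) = x , (begin
      k                 ≈⟨ identityʳ k ⟨
      k ∙ ε             ≈⟨ ∙-congˡ (^-*-period kᵐ≈ε y) ⟨
      k ^ (1 + y * m)   ≡⟨ ≡.cong (k ^_) 1+ym≡xp ⟩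
      k ^ (x * p)       ≈⟨ kˣᵖ≈gˣ x ⟩
      g ^ x             ∎)
    from-identity (Bézout.-+ x y 1+xp≡ym) =
      ∈⟨⟩-resp-≈ (sym (inverseˡ-unique k (g ^ x) kgˣ≈ε)) (∈⟨⟩-⁻¹ (x , refl))
      where
      kgˣ≈ε : k ∙ g ^ x ≈ ε
      kgˣ≈ε = begin
        k ∙ g ^ x         ≈⟨ ∙-congˡ (kˣᵖ≈gˣ x) ⟨
        k ^ (1 + x * p)   ≡⟨ ≡.cong (k ^_) 1+xp≡ym ⟩
        k ^ (y * m)       ≈⟨ ^-*-period kᵐ≈ε y ⟩
        ε                 ∎

  EdgesMeetε : Carrier → Set (c ⊔ ℓ)
  EdgesMeetε x = ∀ {y} → Adj G x y → x ≈ ε ⊎ y ≈ ε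

  clique⊎edgesMeetε⇒TwoK2Free : ∀ {r} (R : Pred Carrier r) →
                                 (∀ {x y} → R x → R y → ¬ x ≈ y → Adj G x y) →
                                 (∀ x → R x ⊎ EdgesMeetε x) → TwoK2Free G
  clique⊎edgesMeetε⇒TwoK2Free R clique split x₁ y₁ x₂ y₂
    (x₁≉x₂ , x₁≉y₂ , y₁≉x₂ , _ , x₁~y₁ , x₂~y₂ , x₁≁x₂ , x₁≁y₂ , y₁≁x₂ , _) =
    impossible (split x₁) (split y₁) (split x₂) (split y₂)
    where
    first-edge-avoids-ε : ¬ (x₁ ≈ ε ⊎ y₁ ≈ ε)
    first-edge-avoids-ε (inj₁ x₁≈ε) = x₁≁x₂ (ε-Adj x₁≈ε x₁≉x₂)
    first-edge-avoids-ε (inj₂ y₁≈ε) = y₁≁x₂ (ε-Adj y₁≈ε y₁≉x₂)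
    second-edge-avoids-ε : ¬ (x₂ ≈ ε ⊎ y₂ ≈ ε)
    second-edge-avoids-ε (inj₁ x₂≈ε) = x₁≁x₂ (Adj-sym (ε-Adj x₂≈ε (x₁≉x₂ ∘ sym)))
    second-edge-avoids-ε (inj₂ y₂≈ε) = x₁≁y₂ (Adj-sym (ε-Adj y₂≈ε (x₁≉y₂ ∘ sym)))
    impossible : R x₁ ⊎ EdgesMeetε x₁ → R y₁ ⊎ EdgesMeetε y₁ →
                 R x₂ ⊎ EdgesMeetε x₂ → R y₂ ⊎ EdgesMeetε y₂ → ⊥
    impossible (inj₂ meet) _ _ _ = first-edge-avoids-ε (meet x₁~y₁)
    impossible _ (inj₂ meet) _ _ = first-edge-avoids-ε (swap (meet (Adj-sym x₁~y₁)))
    impossible _ _ (inj₂ meet) _ = second-edge-avoids-ε (meet x₂~y₂)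
    impossible _ _ _ (inj₂ meet) = second-edge-avoids-ε (swap (meet (Adj-sym x₂~y₂)))
    impossible (inj₁ Rx₁) _ (inj₁ Rx₂) _ = x₁≁x₂ (clique Rx₁ Rx₂ x₁≉x₂)

  cyclic⇒TwoK2Free : IsCyclic G → TwoK2Free G
  cyclic⇒TwoK2Free (g , generated) =
    clique⊎edgesMeetε⇒TwoK2Free (λ _ → ⊤) (λ {x} {y} _ _ x≉y → x≉y , ∈⟨⟩⇒GenCyclic (∈⟨g⟩ x) (∈⟨g⟩ y))
      (λ _ → inj₁ tt)
    where
    ∈⟨g⟩ : ∀ x → x ∈⟨ g ⟩
    ∈⟨g⟩ x = let k , x≈gᵏ = generated x in ∈⟨⟩-resp-≈ (sym x≈gᵏ) (pow∈⟨⟩ g k)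

elementaryAbelian2⇒TwoK2Free : ∀ {c ℓ} (G : Group c ℓ) → IsElemAbelian2 G → TwoK2Free G
elementaryAbelian2⇒TwoK2Free G (_ , x²≈ε) =
  clique⊎edgesMeetε⇒TwoK2Free (λ _ → ⊥) (λ ()) (λ _ → inj₂ edge-meets-ε)
  where
  open Group G
  open Involutions G
  open TorsionGroup G (λ x → 1 , trans (∙-congˡ (identityʳ x)) (x²≈ε x))
  edge-meets-ε : ∀ {x y} → Adj G x y → x ≈ ε ⊎ y ≈ ε
  edge-meets-ε (x≉y , cyclic) = let k , x∈⟨k⟩ , y∈⟨k⟩ = GenCyclic⇒∈⟨⟩ cyclic in
    involution-∈⟨⟩-distinct (x²≈ε k) x∈⟨k⟩ y∈⟨k⟩ x≉y

module FiniteGroup {c ℓ : Level} (G : Group c ℓ) (finite : Finite G) where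
  open Group G
  open import Algebra.Properties.Group G using (x≈z//y; y≈x\\z; ∙-cancelʳ; inverseˡ-unique; ⁻¹-involutive)
  open import Relation.Binary.Reasoning.Setoid setoid
  open Powers G
  open Involutions G
  open Cardinality G

  |G| : ℕ
  |G| = proj₁ finite

  enum : Fin |G| → Carrier
  enum = proj₁ (proj₂ finite)

  index : Carrier → Fin |G|
  index x = proj₁ (proj₁ (proj₂ (proj₂ finite)) x)

  enum-index : ∀ x → enum (index x) ≈ x
  enum-index x = proj₂ (proj₁ (proj₂ (proj₂ finite)) x)

  index-injective : ∀ {x y} → index x ≡ index y → x ≈ y
  index-injective {x} {y} same =
    trans (sym (enum-index x)) (trans (reflexive (≡.cong enum same)) (enum-index y))

  -- Opaque: these searches through the enumeration are never meant to compute, and unfolding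
  -- them (e.g. when abstracting over ∈⟨ g ⟩? x in a with) makes type checking blow up.
  opaque
    infix 4 _≈?_
    _≈?_ : ∀ x y → Dec (x ≈ y)
    x ≈? y = Dec.map′ index-injective ≈⇒index≡ (index x ≟F index y)
      where
      ≈⇒index≡ : x ≈ y → index x ≡ index y
      ≈⇒index≡ x≈y =
        proj₂ (proj₂ (proj₂ finite)) _ _ (trans (enum-index x) (trans x≈y (sym (enum-index y))))

    all-or-counterexample : ∀ {p} {P : Pred Carrier p} → (∀ {x y} → x ≈ y → P x → P y) → Decidable P →
                            (∀ x → P x) ⊎ ∃[ x ] ¬ P x
    all-or-counterexample {P = P} resp P? with all? (P? ∘ enum)
    ... | yes all = inj₁ λ x → resp (enum-index x) (all (index x))
    ... | no ¬all = let i , ¬Pi = ¬∀⟶∃¬ |G| (P ∘ enum) (P? ∘ enum) ¬all in inj₂ (enum i , ¬Pi)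

    torsion : Torsion
    torsion x with pigeonhole (n<1+n |G|) (λ i → index (x ^ toℕ i))
    ... | i , j , i<j , same
      with toℕ j ∸ toℕ i | m<n⇒0<n∸m i<j | ^≈^⇒^∸≈ε (<⇒≤ i<j) (index-injective same)
    ...   | suc t | _ | xᵗ⁺¹≈ε = t , xᵗ⁺¹≈ε

    order-exists : ∀ x → ∃ (IsOrder x)
    order-exists x with least-witness (λ s → x ^ suc s ≈? ε) (proj₁ (torsion x)) (proj₂ (torsion x))
    ... | t , xᵗ⁺¹≈ε , below = suc t , record
      { positive    = s≤s z≤n
      ; annihilates = xᵗ⁺¹≈ε
      ; least       = λ { {suc s} _ xˢ⁺¹≈ε → s≤s (≮⇒≥ λ s<t → below s<t xˢ⁺¹≈ε) }
      }

    maximal-order : ∃₂ λ g n → IsOrder g n × (∀ {x m} → IsOrder x m → m ≤ n)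
    maximal-order = g , order g , proj₂ (order-exists g) , bounded
      where
      order : Carrier → ℕ
      order = proj₁ ∘ order-exists
      elements : List Carrier
      elements = tabulate enum
      g : Carrier
      g = argmax order ε elements
      bounded : ∀ {x m} → IsOrder x m → m ≤ order g
      bounded {x} {m} x-order = ≤-trans (≤-reflexive m≡order)
        (All.lookup (f[xs]≤f[argmax] {f = order} ε elements) (∈-tabulate⁺ (index x)))
        where
        m≡order : m ≡ order (enum (index x))
        m≡order = IsOrder-unique (IsOrder-resp-≈ (sym (enum-index x)) x-order) (proj₂ (order-exists _))

    ∈⟨_⟩? : ∀ x → Decidable (_∈⟨ x ⟩)
    ∈⟨ x ⟩? y with torsion x
    ... | t , xᵗ⁺¹≈ε = Dec.map′
      (λ (r , y≈xʳ) → toℕ r , y≈xʳ)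
      (λ (i , y≈xⁱ) → i mod suc t , trans y≈xⁱ (^-mod xᵗ⁺¹≈ε i))
      (any? λ r → y ≈? x ^ toℕ r)

  open TorsionGroup G torsion

  module CyclicOrDihedral {g n} (g-order : IsOrder g n) (g²≉ε : ¬ g ∙ g ≈ ε)
                          (outside-involution : ∀ {x} → ¬ x ∈⟨ g ⟩ → x ∙ x ≈ ε) where
    instance
      n≢0 : NonZero n
      n≢0 = >-nonZero (positive g-order)

    outside-∙ : ∀ {y z} → ¬ y ∈⟨ g ⟩ → z ∈⟨ g ⟩ → ¬ y ∙ z ∈⟨ g ⟩
    outside-∙ {y} {z} y∉ z∈ yz∈ =
      y∉ (∈⟨⟩-resp-≈ (sym (x≈z//y y z (y ∙ z) refl)) (∈⟨⟩-∙ yz∈ (∈⟨⟩-⁻¹ z∈)))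

    outside-conj : ∀ {y z} → ¬ y ∈⟨ g ⟩ → z ∈⟨ g ⟩ → (y ∙ z) ∙ y ≈ z ⁻¹
    outside-conj y∉ z∈ = inverseˡ-unique _ _ (trans (assoc _ _ _) (outside-involution (outside-∙ y∉ z∈)))

    outside-inverts : ∀ {y z} → ¬ y ∈⟨ g ⟩ → z ∈⟨ g ⟩ → y ∙ z ≈ z ⁻¹ ∙ y
    outside-inverts y∉ z∈ = involution-∙-swap (outside-involution y∉) (outside-conj y∉ z∈)

    outside-coset : ∀ {b x} → ¬ b ∈⟨ g ⟩ → ¬ x ∈⟨ g ⟩ → x ∙ b ∈⟨ g ⟩
    outside-coset {b} {x} b∉ x∉ = decidable-stable (∈⟨ g ⟩? (x ∙ b)) λ xb∉ →
      g²≉ε (≈⁻¹⇒involution (∙-cancelʳ (x ∙ b) g (g ⁻¹)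
        (trans (sym commutes) (outside-inverts xb∉ (x∈⟨x⟩ g)))))
      where
      commutes : (x ∙ b) ∙ g ≈ g ∙ (x ∙ b)
      commutes = begin
        (x ∙ b) ∙ g             ≈⟨ assoc _ _ _ ⟩
        x ∙ (b ∙ g)             ≈⟨ ∙-congˡ (outside-inverts b∉ (x∈⟨x⟩ g)) ⟩
        x ∙ (g ⁻¹ ∙ b)          ≈⟨ assoc _ _ _ ⟨
        (x ∙ g ⁻¹) ∙ b          ≈⟨ ∙-congʳ (outside-inverts x∉ (∈⟨⟩-⁻¹ (x∈⟨x⟩ g))) ⟩
        ((g ⁻¹) ⁻¹ ∙ x) ∙ b     ≈⟨ ∙-congʳ (∙-congʳ (⁻¹-involutive g)) ⟩
        (g ∙ x) ∙ b             ≈⟨ assoc _ _ _ ⟩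
        g ∙ (x ∙ b)             ∎

    rotation-injective : ∀ {i i′ : Fin n} → g ^ toℕ i ≈ g ^ toℕ i′ → i ≡ i′
    rotation-injective = toℕ-injective ∘ ^-injective g-order (toℕ<n _) (toℕ<n _)

    module _ {b} (b∉⟨g⟩ : ¬ b ∈⟨ g ⟩) where
      b²≈ε : b ∙ b ≈ ε
      b²≈ε = outside-involution b∉⟨g⟩

      element : Fin 2 × Fin n → Carrier
      element (j , i) = g ^ toℕ i ∙ b ^ toℕ j

      normal-form : ∀ x → ∃[ i ] ∃[ j ] (x ≈ element (j , i))
      normal-form x with ∈⟨ g ⟩? x
      ... | yes (i , x≈gⁱ) = i mod n , 0F , (begin
        x                       ≈⟨ x≈gⁱ ⟩
        g ^ i                   ≈⟨ ^-mod (annihilates g-order) i ⟩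
        g ^ toℕ (i mod n)       ≈⟨ identityʳ _ ⟨
        g ^ toℕ (i mod n) ∙ ε   ∎)
      ... | no x∉ with outside-coset b∉⟨g⟩ x∉
      ...   | i , xb≈gⁱ = i mod n , 1F , (begin
        x                             ≈⟨ x≈z//y x b _ xb≈gⁱ ⟩
        g ^ i ∙ b ⁻¹                  ≈⟨ ∙-cong (^-mod (annihilates g-order) i) (involution⁻¹ b²≈ε) ⟩
        g ^ toℕ (i mod n) ∙ b         ≈⟨ ∙-congˡ (identityʳ b) ⟨
        g ^ toℕ (i mod n) ∙ (b ∙ ε)   ∎)

      rotation≉reflection : ∀ {i i′} → ¬ element (0F , i) ≈ element (1F , i′)
      rotation≉reflection {i} {i′} e = b∉⟨g⟩ (∈⟨⟩-resp-≈ (sym (y≈x\\z _ _ _ gⁱ′b≈gⁱ))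
                                               (∈⟨⟩-∙ (∈⟨⟩-⁻¹ (toℕ i′ , refl)) (toℕ i , refl)))
        where
        gⁱ′b≈gⁱ : g ^ toℕ i′ ∙ b ≈ g ^ toℕ i
        gⁱ′b≈gⁱ = trans (∙-congˡ (sym (identityʳ b))) (trans (sym e) (identityʳ _))

      element-injective : ∀ {u v} → element u ≈ element v → u ≡ v
      element-injective {0F , i} {0F , i′} e =
        ≡.cong (0F ,_) (rotation-injective {i} {i′} (∙-cancelʳ _ _ _ e))
      element-injective {1F , i} {1F , i′} e =
        ≡.cong (1F ,_) (rotation-injective {i} {i′} (∙-cancelʳ _ _ _ e))
      element-injective {0F , i} {1F , i′} e = ⊥-elim (rotation≉reflection {i} {i′} e)
      element-injective {1F , i} {0F , i′} e = ⊥-elim (rotation≉reflection {i′} {i} (sym e))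

      dihedral : IsDihedral G
      dihedral = n
        , bijection⇒HasOrder *↔× element (λ x → let i , j , x≈ = normal-form x in (j , i) , x≈)
            element-injective
        , g , b , annihilates g-order , b²≈ε , outside-conj b∉⟨g⟩ (x∈⟨x⟩ g) , normal-form

    cyclic⊎dihedral : IsCyclic G ⊎ IsDihedral G
    cyclic⊎dihedral with all-or-counterexample ∈⟨⟩-resp-≈ ∈⟨ g ⟩?
    ... | inj₁ all∈⟨g⟩     = inj₁ (g , λ x → let i , x≈gⁱ = all∈⟨g⟩ x in + i , x≈gⁱ)
    ... | inj₂ (b , b∉⟨g⟩) = inj₂ (dihedral b∉⟨g⟩)

  module MaximalOrder {g n} (g-order : IsOrder g n) (maximal : ∀ {x m} → IsOrder x m → m ≤ n) where
    ∈⟨⟩-flip : ∀ {k} → g ∈⟨ k ⟩ → k ∈⟨ g ⟩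
    ∈⟨⟩-flip {k} (p , g≈kᵖ) = coprime-power⇒∈⟨⟩ {p = p} g≈kᵖ (annihilates k-order)
      (order≤period⇒coprime {p = p} g-order g≈kᵖ (annihilates k-order) (positive k-order) (maximal k-order))
      where
      k-order : IsOrder k (proj₁ (order-exists k))
      k-order = proj₂ (order-exists k)

    Adj⇒∈⟨⟩ : ∀ {u v} → g ∈⟨ u ⟩ → Adj G u v → v ∈⟨ g ⟩
    Adj⇒∈⟨⟩ g∈⟨u⟩ (_ , u,v-cyclic) = let k , u∈⟨k⟩ , v∈⟨k⟩ = GenCyclic⇒∈⟨⟩ u,v-cyclic in
      ∈⟨⟩-trans v∈⟨k⟩ (∈⟨⟩-flip (∈⟨⟩-trans g∈⟨u⟩ u∈⟨k⟩))

    ¬involution⇒g²≉ε : ∀ {h} → ¬ h ∙ h ≈ ε → ¬ g ∙ g ≈ ε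
    ¬involution⇒g²≉ε {h} h²≉ε g²≈ε =
      h²≉ε (order≤2⇒involution h-order (≤-trans (maximal h-order) (involution⇒order≤2 g-order g²≈ε)))
      where
      h-order : IsOrder h (proj₁ (order-exists h))
      h-order = proj₂ (order-exists h)

    non-involution⇒∈⟨⟩ : TwoK2Free G → ¬ g ∙ g ≈ ε → ∀ {h} → ¬ h ∙ h ≈ ε → h ∈⟨ g ⟩
    non-involution⇒∈⟨⟩ free g²≉ε {h} h²≉ε = decidable-stable (∈⟨ g ⟩? h) no-induced-2K₂
      where
      apart : ∀ {u v} → u ∈⟨ g ⟩ → ¬ v ∈⟨ g ⟩ → ¬ u ≈ v
      apart u∈ v∉ u≈v = v∉ (∈⟨⟩-resp-≈ u≈v u∈)
      no-edge : ∀ {u v} → g ∈⟨ u ⟩ → ¬ v ∈⟨ g ⟩ → ¬ Adj G u v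
      no-edge g∈⟨u⟩ v∉ = v∉ ∘ Adj⇒∈⟨⟩ g∈⟨u⟩
      g⁻¹∈⟨g⟩ : g ⁻¹ ∈⟨ g ⟩
      g⁻¹∈⟨g⟩ = ∈⟨⟩-⁻¹ (x∈⟨x⟩ g)
      g∈⟨g⁻¹⟩ : g ∈⟨ g ⁻¹ ⟩
      g∈⟨g⁻¹⟩ = ∈⟨⟩-resp-≈ (⁻¹-involutive g) (∈⟨⟩-⁻¹ (x∈⟨x⟩ (g ⁻¹)))
      no-induced-2K₂ : ¬ ¬ h ∈⟨ g ⟩
      no-induced-2K₂ h∉ = free g (g ⁻¹) h (h ⁻¹)
        ( apart (x∈⟨x⟩ g) h∉ , apart (x∈⟨x⟩ g) h⁻¹∉ , apart g⁻¹∈⟨g⟩ h∉ , apart g⁻¹∈⟨g⟩ h⁻¹∉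
        , Adj-⁻¹ g²≉ε , Adj-⁻¹ h²≉ε
        , no-edge (x∈⟨x⟩ g) h∉ , no-edge (x∈⟨x⟩ g) h⁻¹∉ , no-edge g∈⟨g⁻¹⟩ h∉ , no-edge g∈⟨g⁻¹⟩ h⁻¹∉ )
        where
        h⁻¹∉ : ¬ h ⁻¹ ∈⟨ g ⟩
        h⁻¹∉ = h∉ ∘ ∈⟨⟩-resp-≈ (⁻¹-involutive h) ∘ ∈⟨⟩-⁻¹

    TwoK2Free⇒cyclic⊎dihedral : TwoK2Free G → ∀ {h} → ¬ h ∙ h ≈ ε → IsCyclic G ⊎ IsDihedral G
    TwoK2Free⇒cyclic⊎dihedral free h²≉ε = CyclicOrDihedral.cyclic⊎dihedral g-order g²≉ε outside-involution
      where
      g²≉ε : ¬ g ∙ g ≈ ε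
      g²≉ε = ¬involution⇒g²≉ε h²≉ε
      outside-involution : ∀ {x} → ¬ x ∈⟨ g ⟩ → x ∙ x ≈ ε
      outside-involution {x} x∉ = decidable-stable (x ∙ x ≈? ε) (x∉ ∘ non-involution⇒∈⟨⟩ free g²≉ε)

  TwoK2Free⇒classification : TwoK2Free G → IsCyclic G ⊎ IsDihedral G ⊎ IsElemAbelian2 G
  TwoK2Free⇒classification free
    with all-or-counterexample (λ x≈y x²≈ε → trans (∙-cong (sym x≈y) (sym x≈y)) x²≈ε)
                               (λ x → x ∙ x ≈? ε)
  ... | inj₁ involutions = inj₂ (inj₂ (involutions⇒IsElemAbelian2 involutions))
  ... | inj₂ (h , h²≉ε) = let g , n , g-order , maximal = maximal-order in
    Sum.map₂ inj₁ (MaximalOrder.TwoK2Free⇒cyclic⊎dihedral g-order maximal free h²≉ε)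

module Dihedral {c ℓ : Level} (G : Group c ℓ) where
  open Group G
  open import Algebra.Properties.Group G using (y≈x\\z)
  open import Relation.Binary.Reasoning.Setoid setoid
  open Powers G
  open Involutions G
  open Cardinality G

  module Presentation {n a b} (|G|≡2n : HasOrder G (2 * n)) (aⁿ≈ε : a ^ n ≈ ε) (b²≈ε : b ∙ b ≈ ε)
                      (bab≈a⁻¹ : (b ∙ a) ∙ b ≈ a ⁻¹)
                      (normal-form : ∀ x → ∃[ i ] ∃[ j ] (x ≈ a ^ toℕ {n} i ∙ b ^ toℕ {2} j)) where
    open FiniteGroup G (2 * n , |G|≡2n) using (torsion)
    open TorsionGroup G torsion

    instance
      n≢0 : NonZero n
      n≢0 = nonZeroIndex (proj₁ (normal-form ε))

    Reflection : Carrier → Set ℓ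
    Reflection x = ∃[ i ] (x ≈ a ^ i ∙ b)

    rotation⊎reflection : ∀ x → x ∈⟨ a ⟩ ⊎ Reflection x
    rotation⊎reflection x with normal-form x
    ... | i , 0F , x≈aⁱ  = inj₁ (toℕ i , trans x≈aⁱ (identityʳ _))
    ... | i , 1F , x≈aⁱb = inj₂ (toℕ i , trans x≈aⁱb (∙-congˡ (identityʳ b)))

    b∉⟨a⟩ : ¬ b ∈⟨ a ⟩
    b∉⟨a⟩ b∈⟨a⟩ = <⇒≱ n<2n (surjection⇒order≤ |G|≡2n (λ i → a ^ toℕ i) onto)
      where
      n<2n : n < 2 * n
      n<2n = ≡.subst (n <_) (*-comm n 2) (m<m*n n 2 (s≤s (s≤s z≤n)))
      rotation : ∀ x → x ∈⟨ a ⟩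
      rotation x = [ id , (λ (i , x≈aⁱb) → ∈⟨⟩-resp-≈ (sym x≈aⁱb) (∈⟨⟩-∙ (i , refl) b∈⟨a⟩)) ]
                   (rotation⊎reflection x)
      onto : ∀ x → ∃[ r ] (x ≈ a ^ toℕ r)
      onto x with rotation x
      ... | k , x≈aᵏ = k mod n , trans x≈aᵏ (^-mod aⁿ≈ε k)

    reflection∉⟨a⟩ : ∀ {x} → Reflection x → ¬ x ∈⟨ a ⟩
    reflection∉⟨a⟩ (i , x≈aⁱb) x∈⟨a⟩ =
      b∉⟨a⟩ (∈⟨⟩-resp-≈ (sym (y≈x\\z _ _ _ (sym x≈aⁱb))) (∈⟨⟩-∙ (∈⟨⟩-⁻¹ (i , refl)) x∈⟨a⟩))

    reflection-involution : ∀ {s} → Reflection s → s ∙ s ≈ ε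
    reflection-involution {s} (i , s≈aⁱb) = begin
      s ∙ s                             ≈⟨ ∙-cong s≈aⁱb s≈aⁱb ⟩
      (a ^ i ∙ b) ∙ (a ^ i ∙ b)         ≈⟨ assoc _ _ _ ⟩
      a ^ i ∙ (b ∙ (a ^ i ∙ b))         ≈⟨ ∙-congˡ (assoc _ _ _) ⟨
      a ^ i ∙ ((b ∙ a ^ i) ∙ b)         ≈⟨ ∙-congˡ (∙-congʳ (intertwine-^ ba≈a⁻¹b i)) ⟩
      a ^ i ∙ (((a ⁻¹) ^ i ∙ b) ∙ b)    ≈⟨ ∙-congˡ (assoc _ _ _) ⟩
      a ^ i ∙ ((a ⁻¹) ^ i ∙ (b ∙ b))    ≈⟨ ∙-congˡ (∙-cong (⁻¹-^ a i) b²≈ε) ⟩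
      a ^ i ∙ ((a ^ i) ⁻¹ ∙ ε)          ≈⟨ ∙-congˡ (identityʳ _) ⟩
      a ^ i ∙ (a ^ i) ⁻¹                ≈⟨ inverseʳ _ ⟩
      ε                                 ∎
      where
      ba≈a⁻¹b : b ∙ a ≈ a ⁻¹ ∙ b
      ba≈a⁻¹b = involution-∙-swap b²≈ε bab≈a⁻¹

    reflection-edges : ∀ {s} → Reflection s → EdgesMeetε s
    reflection-edges s-reflection (s≉y , s,y-cyclic) with GenCyclic⇒∈⟨⟩ s,y-cyclic
    ... | k , s∈⟨k⟩ , y∈⟨k⟩ with rotation⊎reflection k
    ...   | inj₁ k∈⟨a⟩       = ⊥-elim (reflection∉⟨a⟩ s-reflection (∈⟨⟩-trans s∈⟨k⟩ k∈⟨a⟩))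
    ...   | inj₂ k-reflection = involution-∈⟨⟩-distinct (reflection-involution k-reflection) s∈⟨k⟩ y∈⟨k⟩ s≉y

    twoK2Free : TwoK2Free G
    twoK2Free = clique⊎edgesMeetε⇒TwoK2Free (_∈⟨ a ⟩) (λ x∈ y∈ x≉y → x≉y , ∈⟨⟩⇒GenCyclic x∈ y∈)
                  (λ x → Sum.map₂ reflection-edges (rotation⊎reflection x))

  dihedral⇒TwoK2Free : IsDihedral G → TwoK2Free G
  dihedral⇒TwoK2Free (n , |G|≡2n , a , b , aⁿ≈ε , b²≈ε , bab≈a⁻¹ , normal-form) =
    Presentation.twoK2Free |G|≡2n aⁿ≈ε b²≈ε bab≈a⁻¹ normal-form

lemma3p2 : {c ℓ : Level} (G : Group c ℓ) → Finite G →
    (TwoK2Free G ⇔ (IsCyclic G ⊎ IsDihedral G ⊎ IsElemAbelian2 G))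
lemma3p2 G finite = mk⇔ TwoK2Free⇒classification
  [ cyclic⇒TwoK2Free , [ dihedral⇒TwoK2Free , elementaryAbelian2⇒TwoK2Free G ] ]
  where
  open FiniteGroup G finite using (torsion; TwoK2Free⇒classification)
  open TorsionGroup G torsion using (cyclic⇒TwoK2Free)
  open Dihedral G using (dihedral⇒TwoK2Free)
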